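{- Let $G,H$ be nontrivial groups. Then $\Gamma_{sc}(G\times H)$ is connected and $\operatorname{diam}(\Gamma_{sc}(G\times H))\le 3$. In particular $\Gamma_{sc}(G\times G)$ is connected with $\operatorname{diam}(\Gamma_{sc}(G\times G))\le 3$. Further, $\operatorname{diam}(\Gamma_{sc}(G\times G))=3$ if and only if either $\Gamma_{sc}(G)$ is disconnected or $\Gamma_{sc}(G)$ is connected with $\operatorname{diam}(\Gamma_{sc}(G))\ge 3$.
   Context: For a group $G$, the SCC-graph $\Gamma_{sc}(G)$ is the simple undirected graph whose vertices are the nontrivial conjugacy classes $x^G=\{gxg^{ -1}:g\in G\}$, $x\ne1$, where two distinct vertices $x^G,y^G$ are adjacent if there exist $x'\in x^G$, $y'\in y^G$ with $\langle x',y'\rangle$ solvable. $\operatorname{diam}$ denotes the diameter (maximum graph distance between vertices). -}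

module Defs where

open import Level using (Level; _⊔_)
open import Algebra.Bundles using (Group)
open import Data.Nat using (ℕ; zero; suc; _≤_)
open import Data.Product using (Σ; ∃; ∃₂; _×_; _,_)
open import Data.Sum using (_⊎_)
open import Relation.Nullary using (¬_)
import Algebra.Construct.DirectProduct as DP

_×G_ : ∀ {c₁ ℓ₁ c₂ ℓ₂} → Group c₁ ℓ₁ → Group c₂ ℓ₂ → Group (c₁ ⊔ c₂) (ℓ₁ ⊔ ℓ₂)
G ×G H = DP.group G H

module _ {c ℓ : Level} (G : Group c ℓ) where
  open Group G

  Nontrivial : Set (c ⊔ ℓ)
  Nontrivial = Σ Carrier λ g → ¬ (g ≈ ε)

  data Gen (P : Carrier → Set (c ⊔ ℓ)) : Carrier → Set (c ⊔ ℓ) where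
    gen  : ∀ {x} → P x → Gen P x
    one  : Gen P ε
    mul  : ∀ {x y} → Gen P x → Gen P y → Gen P (x ∙ y)
    inv  : ∀ {x} → Gen P x → Gen P (x ⁻¹)
    resp : ∀ {x y} → x ≈ y → Gen P x → Gen P y

  data Two (x y : Carrier) : Carrier → Set (c ⊔ ℓ) where
    fst : ∀ {z} → z ≈ x → Two x y z
    snd : ∀ {z} → z ≈ y → Two x y z

  Comms : (Carrier → Set (c ⊔ ℓ)) → Carrier → Set (c ⊔ ℓ)
  Comms Q z = ∃₂ λ a b → Q a × Q b × (z ≈ (((a ⁻¹) ∙ (b ⁻¹)) ∙ a) ∙ b)

  Derived : (Carrier → Set (c ⊔ ℓ)) → ℕ → Carrier → Set (c ⊔ ℓ)
  Derived S zero    = S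
  Derived S (suc n) = Gen (Comms (Derived S n))

  Solvable : (Carrier → Set (c ⊔ ℓ)) → Set (c ⊔ ℓ)
  Solvable S = ∃ λ n → ∀ z → Derived S n z → z ≈ ε

  Conj : Carrier → Carrier → Set (c ⊔ ℓ)
  Conj x y = ∃ λ g → y ≈ (g ∙ x) ∙ (g ⁻¹)

  Nontriv : Carrier → Set ℓ
  Nontriv x = ¬ (x ≈ ε)

  -- Adjacency in Γ_sc(G) of the classes x^G and y^G (distinct vertices)
  Adj : Carrier → Carrier → Set (c ⊔ ℓ)
  Adj x y = ¬ Conj x y × ∃₂ λ x' y' → Conj x x' × Conj y y' × Solvable (Gen (Two x' y'))

  -- Walk of length n in Γ_sc(G) from x^G to y^G (intermediate vertices nontrivial classes)
  data Walk : ℕ → Carrier → Carrier → Set (c ⊔ ℓ) where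
    here : ∀ {x y} → Conj x y → Walk zero x y
    step : ∀ {n x z y} → Nontriv z → Adj x z → Walk n z y → Walk (suc n) x y

  Connected : Set (c ⊔ ℓ)
  Connected = ∀ x y → Nontriv x → Nontriv y → ∃ λ n → Walk n x y

  DiamLe : ℕ → Set (c ⊔ ℓ)
  DiamLe n = ∀ x y → Nontriv x → Nontriv y → ∃ λ k → k ≤ n × Walk k x y

{-# OPTIONS --safe #-}
module Submission where

-- Commuting elements generate an abelian, hence solvable, subgroup. In G × H the elements (1,h₁)
-- and (g₂,1) commute, which joins any (g₁,h₁) to any (g₂,h₂) in at most three steps.
-- Solvability passes to homomorphic images and to subgroups of products, so midpoints in the
-- graphs of G and H combine coordinatewise, while a midpoint between (a,b) and (b,a) in G × G
-- projects to a midpoint between a and b in G: diam(G × G) ≤ 2 exactly when diam(G) ≤ 2.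

open import Defs
open import Algebra.Bundles using (Group)
open import Axiom.ExcludedMiddle using (ExcludedMiddle)
open import Data.Product using (_×_)
open import Data.Sum using (_⊎_)
open import Relation.Nullary using (¬_)
open import Function.Bundles using (_⇔_; mk⇔)

open import Level using (Level; _⊔_)
open import Algebra.Morphism.Structures using (module GroupMorphisms)
import Algebra.Morphism.Construct.Identity as Identity
import Algebra.Morphism.Construct.DirectProduct as DirectProduct
open import Data.Nat using (ℕ; zero; suc; _≤_; _+_; s≤s)
open import Data.Nat.Properties using (≤-refl; ≤-trans; n≤1+n; m≤n⇒m≤1+n; +-comm)
open import Data.Product using (∃; ∃₂; _,_; proj₁; proj₂)
open import Data.Sum using (inj₁; inj₂)
open import Data.Empty using (⊥-elim)
open import Relation.Nullary using (yes; no)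
open import Relation.Binary.PropositionalEquality using (subst)

open GroupMorphisms using (IsGroupHomomorphism)

module GroupFacts {c ℓ : Level} (G : Group c ℓ) where
  open Group G
  open import Algebra.Properties.Group G using (ε⁻¹≈ε; ⁻¹-anti-homo-∙)
  open import Relation.Binary.Reasoning.Setoid setoid

  Trivial : (Carrier → Set (c ⊔ ℓ)) → Set (c ⊔ ℓ)
  Trivial S = ∀ z → S z → z ≈ ε

  Commute : Carrier → Carrier → Set ℓ
  Commute x y = x ∙ y ≈ y ∙ x

  commutator : Carrier → Carrier → Carrier
  commutator a b = ((a ⁻¹ ∙ b ⁻¹) ∙ a) ∙ b

  commutator-cong : ∀ {a a' b b'} → a ≈ a' → b ≈ b' → commutator a b ≈ commutator a' b'
  commutator-cong a≈a' b≈b' = ∙-cong (∙-cong (∙-cong (⁻¹-cong a≈a') (⁻¹-cong b≈b')) a≈a') b≈b'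

  conjugate : Carrier → Carrier → Carrier
  conjugate g x = (g ∙ x) ∙ g ⁻¹

  conjugate-ε : ∀ x → conjugate ε x ≈ x
  conjugate-ε x = trans (∙-cong (identityˡ x) ε⁻¹≈ε) (identityʳ x)

  conjugate-∙ : ∀ h g x → conjugate h (conjugate g x) ≈ conjugate (h ∙ g) x
  conjugate-∙ h g x = begin
    (h ∙ ((g ∙ x) ∙ g ⁻¹)) ∙ h ⁻¹  ≈⟨ ∙-congʳ (sym (assoc h (g ∙ x) (g ⁻¹))) ⟩
    ((h ∙ (g ∙ x)) ∙ g ⁻¹) ∙ h ⁻¹  ≈⟨ assoc _ _ _ ⟩
    (h ∙ (g ∙ x)) ∙ (g ⁻¹ ∙ h ⁻¹)  ≈⟨ ∙-cong (sym (assoc h g x)) (sym (⁻¹-anti-homo-∙ h g)) ⟩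
    ((h ∙ g) ∙ x) ∙ (h ∙ g) ⁻¹     ∎

  conjugate-congʳ : ∀ g {x y} → x ≈ y → conjugate g x ≈ conjugate g y
  conjugate-congʳ g x≈y = ∙-congʳ (∙-congˡ x≈y)

  Conj-refl : ∀ x → Conj G x x
  Conj-refl x = ε , sym (conjugate-ε x)

  Conj-sym : ∀ {x y} → Conj G x y → Conj G y x
  Conj-sym {x} {y} (g , y≈gx) = g ⁻¹ , (begin
    x                               ≈⟨ sym (conjugate-ε x) ⟩
    conjugate ε x                   ≈⟨ ∙-cong (∙-congʳ (sym (inverseˡ g))) (⁻¹-cong (sym (inverseˡ g))) ⟩
    conjugate (g ⁻¹ ∙ g) x          ≈⟨ sym (conjugate-∙ (g ⁻¹) g x) ⟩
    conjugate (g ⁻¹) (conjugate g x) ≈⟨ conjugate-congʳ (g ⁻¹) (sym y≈gx) ⟩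
    conjugate (g ⁻¹) y              ∎)

  Conj-trans : ∀ {x y z} → Conj G x y → Conj G y z → Conj G x z
  Conj-trans {x} (g , y≈gx) (h , z≈hy) =
    h ∙ g , trans z≈hy (trans (conjugate-congʳ h y≈gx) (conjugate-∙ h g x))

  commute-sym : ∀ {x y} → Commute x y → Commute y x
  commute-sym = sym

  ≈ε⇒commuteˡ : ∀ {x y} → x ≈ ε → Commute x y
  ≈ε⇒commuteˡ {x} {y} x≈ε = begin
    x ∙ y  ≈⟨ ∙-congʳ x≈ε ⟩
    ε ∙ y  ≈⟨ identityˡ y ⟩
    y      ≈⟨ sym (identityʳ y) ⟩
    y ∙ ε  ≈⟨ ∙-congˡ (sym x≈ε) ⟩
    y ∙ x  ∎

  ≈ε⇒commuteʳ : ∀ {x y} → y ≈ ε → Commute x y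
  ≈ε⇒commuteʳ y≈ε = commute-sym (≈ε⇒commuteˡ y≈ε)

  commute-∙ʳ : ∀ {a x y} → Commute a x → Commute a y → Commute a (x ∙ y)
  commute-∙ʳ {a} {x} {y} ax ay = begin
    a ∙ (x ∙ y)  ≈⟨ sym (assoc _ _ _) ⟩
    (a ∙ x) ∙ y  ≈⟨ ∙-congʳ ax ⟩
    (x ∙ a) ∙ y  ≈⟨ assoc _ _ _ ⟩
    x ∙ (a ∙ y)  ≈⟨ ∙-congˡ ay ⟩
    x ∙ (y ∙ a)  ≈⟨ sym (assoc _ _ _) ⟩
    (x ∙ y) ∙ a  ∎

  commute-⁻¹ʳ : ∀ {a x} → Commute a x → Commute a (x ⁻¹)
  commute-⁻¹ʳ {a} {x} ax = begin
    a ∙ x ⁻¹                  ≈⟨ sym (identityˡ _) ⟩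
    ε ∙ (a ∙ x ⁻¹)            ≈⟨ ∙-congʳ (sym (inverseˡ x)) ⟩
    (x ⁻¹ ∙ x) ∙ (a ∙ x ⁻¹)   ≈⟨ assoc _ _ _ ⟩
    x ⁻¹ ∙ (x ∙ (a ∙ x ⁻¹))   ≈⟨ ∙-congˡ (sym (assoc _ _ _)) ⟩
    x ⁻¹ ∙ ((x ∙ a) ∙ x ⁻¹)   ≈⟨ ∙-congˡ (∙-congʳ (sym ax)) ⟩
    x ⁻¹ ∙ ((a ∙ x) ∙ x ⁻¹)   ≈⟨ ∙-congˡ (assoc _ _ _) ⟩
    x ⁻¹ ∙ (a ∙ (x ∙ x ⁻¹))   ≈⟨ ∙-congˡ (∙-congˡ (inverseʳ x)) ⟩
    x ⁻¹ ∙ (a ∙ ε)            ≈⟨ ∙-congˡ (identityʳ a) ⟩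
    x ⁻¹ ∙ a                  ∎

  commute-respʳ : ∀ {a x y} → x ≈ y → Commute a x → Commute a y
  commute-respʳ x≈y ax = trans (∙-congˡ (sym x≈y)) (trans ax (∙-congʳ x≈y))

  Gen-commute : ∀ {P a} → (∀ {p} → P p → Commute a p) → ∀ {z} → Gen G P z → Commute a z
  Gen-commute aP (gen p)         = aP p
  Gen-commute aP one             = ≈ε⇒commuteʳ refl
  Gen-commute aP (mul gx gy)     = commute-∙ʳ (Gen-commute aP gx) (Gen-commute aP gy)
  Gen-commute aP (inv gx)        = commute-⁻¹ʳ (Gen-commute aP gx)
  Gen-commute aP (resp x≈y gx)   = commute-respʳ x≈y (Gen-commute aP gx)

  Gen-abelian : ∀ {P} → (∀ {p q} → P p → P q → Commute p q) →
                ∀ {u v} → Gen G P u → Gen G P v → Commute u v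
  Gen-abelian PP gu gv =
    commute-sym (Gen-commute (λ p → commute-sym (Gen-commute (PP p) gv)) gu)

  commutator≈ε : ∀ {a b} → Commute a b → commutator a b ≈ ε
  commutator≈ε {a} {b} ab = begin
    ((a ⁻¹ ∙ b ⁻¹) ∙ a) ∙ b  ≈⟨ assoc _ _ _ ⟩
    (a ⁻¹ ∙ b ⁻¹) ∙ (a ∙ b)  ≈⟨ ∙-congʳ (sym (⁻¹-anti-homo-∙ b a)) ⟩
    (b ∙ a) ⁻¹ ∙ (a ∙ b)     ≈⟨ ∙-congʳ (⁻¹-cong (sym ab)) ⟩
    (a ∙ b) ⁻¹ ∙ (a ∙ b)     ≈⟨ inverseˡ (a ∙ b) ⟩
    ε                        ∎

  Gen-trivial : ∀ {P} → Trivial P → Trivial (Gen G P)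
  Gen-trivial P≈ε _ (gen p)       = P≈ε _ p
  Gen-trivial P≈ε _ one           = refl
  Gen-trivial P≈ε _ (mul gx gy)   =
    trans (∙-cong (Gen-trivial P≈ε _ gx) (Gen-trivial P≈ε _ gy)) (identityˡ ε)
  Gen-trivial P≈ε _ (inv gx)      = trans (⁻¹-cong (Gen-trivial P≈ε _ gx)) ε⁻¹≈ε
  Gen-trivial P≈ε _ (resp x≈y gx) = trans (sym x≈y) (Gen-trivial P≈ε _ gx)

  Comms-trivial : ∀ {Q} → Trivial Q → Trivial (Comms G Q)
  Comms-trivial Q≈ε z (a , b , qa , qb , z≈[a,b]) =
    trans z≈[a,b] (commutator≈ε (≈ε⇒commuteˡ (Q≈ε a qa)))

  Derived-trivial-+ : ∀ S n → Trivial (Derived G S n) → ∀ k → Trivial (Derived G S (k + n))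
  Derived-trivial-+ S n trivial zero    = trivial
  Derived-trivial-+ S n trivial (suc k) = Gen-trivial (Comms-trivial (Derived-trivial-+ S n trivial k))

  abelian⇒solvable : ∀ {P} → (∀ {p q} → P p → P q → Commute p q) → Solvable G (Gen G P)
  abelian⇒solvable PP = 1 , Gen-trivial λ { z (a , b , ga , gb , z≈[a,b]) →
    trans z≈[a,b] (commutator≈ε (Gen-abelian PP ga gb)) }

  commuting⇒solvable : ∀ {x y} → Commute x y → Solvable G (Gen G (Two G x y))
  commuting⇒solvable {x} {y} xy = abelian⇒solvable pairwise
    where
    pairwise : ∀ {p q} → Two G x y p → Two G x y q → Commute p q
    pairwise (fst p≈x) (fst q≈x) = trans (∙-cong p≈x q≈x) (sym (∙-cong q≈x p≈x))
    pairwise (fst p≈x) (snd q≈y) = trans (∙-cong p≈x q≈y) (trans xy (sym (∙-cong q≈y p≈x)))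
    pairwise (snd p≈y) (fst q≈x) = trans (∙-cong p≈y q≈x) (trans (sym xy) (sym (∙-cong q≈x p≈y)))
    pairwise (snd p≈y) (snd q≈y) = trans (∙-cong p≈y q≈y) (sym (∙-cong q≈y p≈y))

module Homomorphism {c₁ ℓ₁ c₂ ℓ₂ : Level} (K : Group c₁ ℓ₁) (L : Group c₂ ℓ₂)
  {f : Group.Carrier K → Group.Carrier L}
  (isHom : IsGroupHomomorphism (Group.rawGroup K) (Group.rawGroup L) f) where
  private
    module K = Group K
    module L = Group L
    module KF = GroupFacts K
    module LF = GroupFacts L
  open IsGroupHomomorphism isHom

  commutator-homo : ∀ a b → f (KF.commutator a b) L.≈ LF.commutator (f a) (f b)
  commutator-homo a b = L.trans (homo _ _) (L.∙-congʳ (L.trans (homo _ _) (L.∙-congʳ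
    (L.trans (homo _ _) (L.∙-cong (⁻¹-homo a) (⁻¹-homo b))))))

  Gen-map : ∀ {P P'} → (∀ {z} → P z → P' (f z)) → ∀ {z} → Gen K P z → Gen L P' (f z)
  Gen-map PP' (gen p)       = gen (PP' p)
  Gen-map PP' one           = resp (L.sym ε-homo) one
  Gen-map PP' (mul gx gy)   = resp (L.sym (homo _ _)) (mul (Gen-map PP' gx) (Gen-map PP' gy))
  Gen-map PP' (inv gx)      = resp (L.sym (⁻¹-homo _)) (inv (Gen-map PP' gx))
  Gen-map PP' (resp x≈y gx) = resp (⟦⟧-cong x≈y) (Gen-map PP' gx)

  Comms-map : ∀ {Q Q'} → (∀ {z} → Q z → Q' (f z)) → ∀ {z} → Comms K Q z → Comms L Q' (f z)
  Comms-map QQ' (a , b , qa , qb , z≈[a,b]) =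
    f a , f b , QQ' qa , QQ' qb , L.trans (⟦⟧-cong z≈[a,b]) (commutator-homo a b)

  Derived-map : ∀ {S S'} → (∀ {z} → S z → S' (f z)) →
                ∀ n {z} → Derived K S n z → Derived L S' n (f z)
  Derived-map SS' zero    d = SS' d
  Derived-map SS' (suc n) d = Gen-map (Comms-map (Derived-map SS' n)) d

  Image : (K.Carrier → Set (c₁ ⊔ ℓ₁)) → L.Carrier → Set (c₁ ⊔ ℓ₁ ⊔ ℓ₂)
  Image S z = ∃ λ w → S w × f w L.≈ z

  Gen-image : ∀ {P P'} → (∀ {z} → P' z → Image P z) → ∀ {z} → Gen L P' z → Image (Gen K P) z
  Gen-image P'⊆fP (gen p) with P'⊆fP p
  ... | w , pw , fw≈z = w , gen pw , fw≈z
  Gen-image P'⊆fP one = K.ε , one , ε-homo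
  Gen-image P'⊆fP (mul gx gy) with Gen-image P'⊆fP gx | Gen-image P'⊆fP gy
  ... | w₁ , g₁ , fw₁≈x | w₂ , g₂ , fw₂≈y =
    w₁ K.∙ w₂ , mul g₁ g₂ , L.trans (homo w₁ w₂) (L.∙-cong fw₁≈x fw₂≈y)
  Gen-image P'⊆fP (inv gx) with Gen-image P'⊆fP gx
  ... | w , g , fw≈x = w K.⁻¹ , inv g , L.trans (⁻¹-homo w) (L.⁻¹-cong fw≈x)
  Gen-image P'⊆fP (resp x≈y gx) with Gen-image P'⊆fP gx
  ... | w , g , fw≈x = w , g , L.trans fw≈x x≈y

  Comms-image : ∀ {Q Q'} → (∀ {z} → Q' z → Image Q z) → ∀ {z} → Comms L Q' z → Image (Comms K Q) z
  Comms-image Q'⊆fQ (a , b , qa , qb , z≈[a,b]) with Q'⊆fQ qa | Q'⊆fQ qb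
  ... | wa , pa , fwa≈a | wb , pb , fwb≈b =
    KF.commutator wa wb , (wa , wb , pa , pb , K.refl) ,
    L.trans (commutator-homo wa wb) (L.trans (LF.commutator-cong fwa≈a fwb≈b) (L.sym z≈[a,b]))

  Derived-image : ∀ {S S'} → (∀ {z} → S' z → Image S z) →
                  ∀ n {z} → Derived L S' n z → Image (Derived K S n) z
  Derived-image S'⊆fS zero    d = S'⊆fS d
  Derived-image S'⊆fS (suc n) d = Gen-image (Comms-image (Derived-image S'⊆fS n)) d

  solvable-image : ∀ {S S'} → (∀ {z} → S' z → Image S z) → Solvable K S → Solvable L S'
  solvable-image S'⊆fS (n , trivial) = n , λ z d →
    let (w , dw , fw≈z) = Derived-image S'⊆fS n d
    in L.trans (L.sym fw≈z) (L.trans (⟦⟧-cong (trivial w dw)) ε-homo)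

module Relatedness {c ℓ : Level} (G : Group c ℓ) where
  open Group G
  open GroupFacts G

  SolvablyRelated : Carrier → Carrier → Set (c ⊔ ℓ)
  SolvablyRelated x y = ∃₂ λ x' y' → Conj G x x' × Conj G y y' × Solvable G (Gen G (Two G x' y'))

  related-respˡ : ∀ {x₂ x y} → Conj G x₂ x → SolvablyRelated x y → SolvablyRelated x₂ y
  related-respˡ x₂~x (x' , y' , x~x' , y~y' , solvable) = x' , y' , Conj-trans x₂~x x~x' , y~y' , solvable

  related-respʳ : ∀ {x y y₂} → SolvablyRelated x y → Conj G y y₂ → SolvablyRelated x y₂
  related-respʳ (x' , y' , x~x' , y~y' , solvable) y~y₂ =
    x' , y' , x~x' , Conj-trans (Conj-sym y~y₂) y~y' , solvable

  commuting⇒related : ∀ {x y} → Commute x y → SolvablyRelated x y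
  commuting⇒related {x} {y} xy = x , y , Conj-refl x , Conj-refl y , commuting⇒solvable xy

  related-refl : ∀ x → SolvablyRelated x x
  related-refl x = commuting⇒related {x} refl

  conj⇒related : ∀ {x y} → Conj G x y → SolvablyRelated x y
  conj⇒related {y = y} x~y = related-respˡ x~y (related-refl y)

  related-sym : ∀ {x y} → SolvablyRelated x y → SolvablyRelated y x
  related-sym (x' , y' , x~x' , y~y' , solvable) = y' , x' , y~y' , x~x' ,
    solvable-image (λ {z} g → z , Gen-map swap g , refl) solvable
    where
    open Homomorphism G G (Identity.isGroupHomomorphism rawGroup refl)
    swap : ∀ {z} → Two G y' x' z → Two G x' y' z
    swap (fst z≈y') = snd z≈y'
    swap (snd z≈x') = fst z≈x'

module SolvableConjugacyGraph {c ℓ : Level} (em : ∀ {a} → ExcludedMiddle a) (G : Group c ℓ) where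
  open Group G
  open GroupFacts G
  open Relatedness G

  WalkWithin : ℕ → Carrier → Carrier → Set (c ⊔ ℓ)
  WalkWithin n x y = ∃ λ k → k ≤ n × Walk G k x y

  walkWithin-refl : ∀ y → WalkWithin 0 y y
  walkWithin-refl y = 0 , ≤-refl , here (Conj-refl y)

  walkWithin-weaken : ∀ {m n x y} → m ≤ n → WalkWithin m x y → WalkWithin n x y
  walkWithin-weaken m≤n (k , k≤m , walk) = k , ≤-trans k≤m m≤n , walk

  walk-respˡ : ∀ {k x z y} → Conj G x z → Walk G k z y → Walk G k x y
  walk-respˡ x~z (here z~y) = here (Conj-trans x~z z~y)
  walk-respˡ x~z (step nw (z≁w , z∼w) walk) =
    step nw ((λ x~w → z≁w (Conj-trans (Conj-sym x~z) x~w)) , related-respˡ x~z z∼w) walk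

  -- A related but conjugate first vertex is the same vertex of the graph: the walk is not extended.
  prepend : ∀ {n x z y} → Nontriv G z → SolvablyRelated x z → WalkWithin n z y → WalkWithin (suc n) x y
  prepend {n} {x} {z} nz x∼z (k , k≤n , walk) with em {P = Conj G x z}
  ... | yes x~z = k , m≤n⇒m≤1+n k≤n , walk-respˡ x~z walk
  ... | no x≁z  = suc k , s≤s k≤n , step nz (x≁z , x∼z) walk

  diam⇒connected : ∀ n → DiamLe G n → Connected G
  diam⇒connected n diam x y nx ny with diam x y nx ny
  ... | k , _ , walk = k , walk

  nontrivial-commuting : Nontrivial G → ∀ g → ∃ λ w → Nontriv G w × Commute w g
  nontrivial-commuting (a , a≉ε) g with em {P = g ≈ ε}
  ... | yes g≈ε = a , a≉ε , ≈ε⇒commuteʳ g≈ε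
  ... | no g≉ε  = g , g≉ε , refl

  HasMidpoints : Set (c ⊔ ℓ)
  HasMidpoints = ∀ a b → Nontriv G a → Nontriv G b →
    ∃ λ u → Nontriv G u × SolvablyRelated a u × SolvablyRelated u b

  midpoints⇒diam≤2 : HasMidpoints → DiamLe G 2
  midpoints⇒diam≤2 midpoints a b na nb with midpoints a b na nb
  ... | u , nu , a∼u , u∼b = prepend nu a∼u (prepend nb u∼b (walkWithin-refl b))

  diam≤2⇒midpoints : DiamLe G 2 → HasMidpoints
  diam≤2⇒midpoints diam a b na nb with diam a b na nb
  ... | .0 , _ , here a~b = b , nb , conj⇒related a~b , conj⇒related (Conj-refl b)
  ... | .1 , _ , step nz (_ , a∼z) (here z~b) = _ , nz , a∼z , conj⇒related z~b
  ... | .2 , _ , step nz (_ , a∼z) (step _ (_ , z∼w) (here w~b)) =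
    _ , nz , a∼z , related-respʳ z∼w w~b
  ... | _ , s≤s (s≤s ()) , step _ _ (step _ _ (step _ _ _))

  -- Stated contrapositively so that a nontrivial (g₁,h₁) yields a nontrivial product midpoint
  -- without excluded middle.
  midpoint-or-trivial : HasMidpoints → ∀ g₁ g₂ →
    ∃ λ w → SolvablyRelated g₁ w × SolvablyRelated w g₂ × (w ≈ ε → g₁ ≈ ε)
  midpoint-or-trivial midpoints g₁ g₂ with em {P = g₁ ≈ ε} | em {P = g₂ ≈ ε}
  ... | yes g₁≈ε | _ = g₂ , commuting⇒related (≈ε⇒commuteˡ g₁≈ε) , related-refl g₂ , λ _ → g₁≈ε
  ... | no g₁≉ε | yes g₂≈ε =
    g₁ , related-refl g₁ , commuting⇒related (≈ε⇒commuteʳ g₂≈ε) , λ g₁≈ε → ⊥-elim (g₁≉ε g₁≈ε)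
  ... | no g₁≉ε | no g₂≉ε with midpoints g₁ g₂ g₁≉ε g₂≉ε
  ... | u , u≉ε , g₁∼u , u∼g₂ = u , g₁∼u , u∼g₂ , λ u≈ε → ⊥-elim (u≉ε u≈ε)

module Product {c₁ ℓ₁ c₂ ℓ₂ : Level} (G : Group c₁ ℓ₁) (H : Group c₂ ℓ₂) where
  private
    module G = Group G
    module H = Group H
    module GF = GroupFacts G
    module HF = GroupFacts H
    module GR = Relatedness G
    module HR = Relatedness H
    module DP = DirectProduct.Monoid G.rawMonoid H.rawMonoid
  open Relatedness (G ×G H) using (SolvablyRelated)

  proj₁-isGroupHomomorphism : IsGroupHomomorphism (Group.rawGroup (G ×G H)) G.rawGroup proj₁
  proj₁-isGroupHomomorphism = record
    { isMonoidHomomorphism = DP.Proj₁.isMonoidHomomorphism G.refl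
    ; ⁻¹-homo              = λ _ → G.refl
    }

  proj₂-isGroupHomomorphism : IsGroupHomomorphism (Group.rawGroup (G ×G H)) H.rawGroup proj₂
  proj₂-isGroupHomomorphism = record
    { isMonoidHomomorphism = DP.Proj₂.isMonoidHomomorphism H.refl
    ; ⁻¹-homo              = λ _ → H.refl
    }

  private
    module π₁ = Homomorphism (G ×G H) G proj₁-isGroupHomomorphism
    module π₂ = Homomorphism (G ×G H) H proj₂-isGroupHomomorphism

  commuting-× : ∀ {g₁ g₂ h₁ h₂} → GF.Commute g₁ g₂ → HF.Commute h₁ h₂ →
                SolvablyRelated (g₁ , h₁) (g₂ , h₂)
  commuting-× g₁g₂ h₁h₂ = Relatedness.commuting⇒related (G ×G H) (g₁g₂ , h₁h₂)

  -- The (n+m)-th derived subgroup projects into the (n+m)-th derived subgroups of both factors,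
  -- which are trivial.
  related-× : ∀ {a b c d} → GR.SolvablyRelated a b → HR.SolvablyRelated c d →
              SolvablyRelated (a , c) (b , d)
  related-× (a' , b' , a~a' , b~b' , (m , trivialᴳ)) (c' , d' , c~c' , d~d' , (n , trivialᴴ)) =
    (a' , c') , (b' , d') , (a~a' ⟨,⟩ c~c') , (b~b' ⟨,⟩ d~d') , (n + m , trivial)
    where
    _⟨,⟩_ : ∀ {x x' y y'} → Conj G x x' → Conj H y y' → Conj (G ×G H) (x , y) (x' , y')
    (g , x'≈gx) ⟨,⟩ (h , y'≈hy) = (g , h) , (x'≈gx , y'≈hy)
    Sᴾ = Gen (G ×G H) (Two (G ×G H) (a' , c') (b' , d'))
    Sᴳ = Gen G (Two G a' b')
    Sᴴ = Gen H (Two H c' d')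
    Sᴾ⊆Sᴳ : ∀ {z} → Sᴾ z → Sᴳ (proj₁ z)
    Sᴾ⊆Sᴳ = π₁.Gen-map λ { (fst (z≈a' , _)) → fst z≈a' ; (snd (z≈b' , _)) → snd z≈b' }
    Sᴾ⊆Sᴴ : ∀ {z} → Sᴾ z → Sᴴ (proj₂ z)
    Sᴾ⊆Sᴴ = π₂.Gen-map λ { (fst (_ , z≈c')) → fst z≈c' ; (snd (_ , z≈d')) → snd z≈d' }
    trivial : ∀ z → Derived (G ×G H) Sᴾ (n + m) z → Group._≈_ (G ×G H) z (Group.ε (G ×G H))
    trivial z d =
      GF.Derived-trivial-+ Sᴳ m trivialᴳ n (proj₁ z) (π₁.Derived-map Sᴾ⊆Sᴳ (n + m) d) ,
      HF.Derived-trivial-+ Sᴴ n trivialᴴ m (proj₂ z)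
        (subst (λ k → Derived H Sᴴ k (proj₂ z)) (+-comm n m) (π₂.Derived-map Sᴾ⊆Sᴴ (n + m) d))

  related-proj₁ : ∀ {x y} → SolvablyRelated x y → GR.SolvablyRelated (proj₁ x) (proj₁ y)
  related-proj₁ (x' , y' , ((g , _) , x'≈gx , _) , ((g' , _) , y'≈g'y , _) , solvable) =
    proj₁ x' , proj₁ y' , (g , x'≈gx) , (g' , y'≈g'y) ,
    π₁.solvable-image (π₁.Gen-image λ { (fst z≈x') → x' , fst (Group.refl (G ×G H)) , G.sym z≈x'
                                      ; (snd z≈y') → y' , snd (Group.refl (G ×G H)) , G.sym z≈y' })
      solvable

  related-proj₂ : ∀ {x y} → SolvablyRelated x y → HR.SolvablyRelated (proj₂ x) (proj₂ y)
  related-proj₂ (x' , y' , ((_ , h) , _ , x'≈hx) , ((_ , h') , _ , y'≈h'y) , solvable) =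
    proj₂ x' , proj₂ y' , (h , x'≈hx) , (h' , y'≈h'y) ,
    π₂.solvable-image (π₂.Gen-image λ { (fst z≈x') → x' , fst (Group.refl (G ×G H)) , H.sym z≈x'
                                      ; (snd z≈y') → y' , snd (Group.refl (G ×G H)) , H.sym z≈y' })
      solvable
module ProductDiameter {c₁ ℓ₁ c₂ ℓ₂ : Level} (em : ∀ {a} → ExcludedMiddle a)
  (G : Group c₁ ℓ₁) (H : Group c₂ ℓ₂) where
  private
    module G = Group G
    module H = Group H
    module GF = GroupFacts G
    module HF = GroupFacts H
    module GΓ = SolvableConjugacyGraph em G
    module HΓ = SolvableConjugacyGraph em H
    module PΓ = SolvableConjugacyGraph em (G ×G H)
  open Product G H

  -- Generically (g₁,h₁) — (1,h₁) — (g₂,1) — (g₂,h₂); if h₁ = 1 or g₂ = 1 a shortcut of length 2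
  -- goes through an element commuting with the other coordinate.
  diam≤3-× : Nontrivial G → Nontrivial H → DiamLe (G ×G H) 3
  diam≤3-× ntG ntH (g₁ , h₁) (g₂ , h₂) _ ny with em {P = h₁ H.≈ H.ε} | em {P = g₂ G.≈ G.ε}
  ... | no h₁≉ε | no g₂≉ε =
    PΓ.prepend (λ (_ , h₁≈ε) → h₁≉ε h₁≈ε) (commuting-× (GF.≈ε⇒commuteʳ G.refl) H.refl)
      (PΓ.prepend (λ (g₂≈ε , _) → g₂≉ε g₂≈ε)
        (commuting-× (GF.≈ε⇒commuteˡ G.refl) (HF.≈ε⇒commuteʳ H.refl))
        (PΓ.prepend ny (commuting-× G.refl (HF.≈ε⇒commuteˡ H.refl)) (PΓ.walkWithin-refl _)))
  ... | yes h₁≈ε | _ with HΓ.nontrivial-commuting ntH h₂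
  ... | w , w≉ε , wh₂ = PΓ.walkWithin-weaken (n≤1+n 2)
    (PΓ.prepend (λ (_ , w≈ε) → w≉ε w≈ε) (commuting-× (GF.≈ε⇒commuteʳ G.refl) (HF.≈ε⇒commuteˡ h₁≈ε))
      (PΓ.prepend ny (commuting-× (GF.≈ε⇒commuteˡ G.refl) wh₂) (PΓ.walkWithin-refl _)))
  diam≤3-× ntG ntH (g₁ , h₁) (g₂ , h₂) _ ny | no _ | yes g₂≈ε with GΓ.nontrivial-commuting ntG g₁
  ... | v , v≉ε , vg₁ = PΓ.walkWithin-weaken (n≤1+n 2)
    (PΓ.prepend (λ (v≈ε , _) → v≉ε v≈ε) (commuting-× (GF.commute-sym vg₁) (HF.≈ε⇒commuteʳ H.refl))
      (PΓ.prepend ny (commuting-× (GF.≈ε⇒commuteʳ g₂≈ε) (HF.≈ε⇒commuteˡ H.refl)) (PΓ.walkWithin-refl _)))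

  connected-× : Nontrivial G → Nontrivial H → Connected (G ×G H)
  connected-× ntG ntH = PΓ.diam⇒connected 3 (diam≤3-× ntG ntH)

  midpoints-× : GΓ.HasMidpoints → HΓ.HasMidpoints → PΓ.HasMidpoints
  midpoints-× midpointsᴳ midpointsᴴ (g₁ , h₁) (g₂ , h₂) nx _
    with GΓ.midpoint-or-trivial midpointsᴳ g₁ g₂ | HΓ.midpoint-or-trivial midpointsᴴ h₁ h₂
  ... | v , g₁∼v , v∼g₂ , v≈ε⇒g₁≈ε | w , h₁∼w , w∼h₂ , w≈ε⇒h₁≈ε =
    (v , w) , (λ (v≈ε , w≈ε) → nx (v≈ε⇒g₁≈ε v≈ε , w≈ε⇒h₁≈ε w≈ε)) ,
    related-× g₁∼v h₁∼w , related-× v∼g₂ w∼h₂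

  diam≤2-× : DiamLe G 2 → DiamLe H 2 → DiamLe (G ×G H) 2
  diam≤2-× diamᴳ diamᴴ =
    PΓ.midpoints⇒diam≤2 (midpoints-× (GΓ.diam≤2⇒midpoints diamᴳ) (HΓ.diam≤2⇒midpoints diamᴴ))

module SquareDiameter {c ℓ : Level} (em : ∀ {a} → ExcludedMiddle a) (G : Group c ℓ) where
  private
    module G = Group G
    module GΓ = SolvableConjugacyGraph em G
    module PΓ = SolvableConjugacyGraph em (G ×G G)
    module GR = Relatedness G
  open Product G G

  -- A midpoint (u,v) between (a,b) and (b,a) projects to a midpoint between a and b
  -- in whichever coordinate it is nontrivial.
  midpoints-square⇒midpoints : PΓ.HasMidpoints → GΓ.HasMidpoints
  midpoints-square⇒midpoints midpoints a b a≉ε b≉ε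
    with midpoints (a , b) (b , a) (λ (a≈ε , _) → a≉ε a≈ε) (λ (b≈ε , _) → b≉ε b≈ε)
  ... | (u , v) , uv≉ε , ab∼uv , uv∼ba with em {P = u G.≈ G.ε}
  ... | no u≉ε  = u , u≉ε , related-proj₁ ab∼uv , related-proj₁ uv∼ba
  ... | yes u≈ε = v , (λ v≈ε → uv≉ε (u≈ε , v≈ε)) ,
    GR.related-sym (related-proj₂ uv∼ba) , GR.related-sym (related-proj₂ ab∼uv)

  diam≤2-square⇒diam≤2 : DiamLe (G ×G G) 2 → DiamLe G 2
  diam≤2-square⇒diam≤2 diam =
    GΓ.midpoints⇒diam≤2 (midpoints-square⇒midpoints (PΓ.diam≤2⇒midpoints diam))

mainTheorem5 : (em : ∀ {a} → ExcludedMiddle a) →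
    ∀ {c₁ ℓ₁ c₂ ℓ₂} (G : Group c₁ ℓ₁) → Nontrivial G →
    (((H : Group c₂ ℓ₂) → Nontrivial H →
    Connected (G ×G H) × DiamLe (G ×G H) 3)
    × (Connected (G ×G G) × DiamLe (G ×G G) 3
    × ((DiamLe (G ×G G) 3 × ¬ DiamLe (G ×G G) 2)
    ⇔ (¬ Connected G ⊎ (Connected G × ¬ DiamLe G 2)))))
mainTheorem5 em G ntG =
  (λ H ntH → ProductDiameter.connected-× em G H ntG ntH , ProductDiameter.diam≤3-× em G H ntG ntH) ,
  (connected-× ntG ntG , diam≤3-× ntG ntG , mk⇔ diam≡3⇒ ⇒diam≡3)
  where
  open ProductDiameter em G G using (connected-×; diam≤3-×; diam≤2-×)
  open SquareDiameter em G using (diam≤2-square⇒diam≤2)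
  open SolvableConjugacyGraph em G using (diam⇒connected)

  diam≡3⇒ : DiamLe (G ×G G) 3 × ¬ DiamLe (G ×G G) 2 → ¬ Connected G ⊎ (Connected G × ¬ DiamLe G 2)
  diam≡3⇒ (_ , ¬diam≤2ᴳᴳ) with em {P = DiamLe G 2} | em {P = Connected G}
  ... | yes diam≤2 | _        = ⊥-elim (¬diam≤2ᴳᴳ (diam≤2-× diam≤2 diam≤2))
  ... | no ¬diam≤2 | yes conn = inj₂ (conn , ¬diam≤2)
  ... | no _       | no ¬conn = inj₁ ¬conn

  ⇒diam≡3 : ¬ Connected G ⊎ (Connected G × ¬ DiamLe G 2) → DiamLe (G ×G G) 3 × ¬ DiamLe (G ×G G) 2
  ⇒diam≡3 (inj₁ ¬conn) =
    diam≤3-× ntG ntG , λ diam≤2 → ¬conn (diam⇒connected 2 (diam≤2-square⇒diam≤2 diam≤2))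
  ⇒diam≡3 (inj₂ (_ , ¬diam≤2)) =
    diam≤3-× ntG ntG , λ diam≤2 → ¬diam≤2 (diam≤2-square⇒diam≤2 diam≤2)
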